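{- For any integers $a,b,c\ge0$, at least one of the following holds: (1) $(a,b,c)$ is a nonnegative integer multiple of $(1,2,0)$ or of $(1,0,2)$; (2) $a>\frac{b+c}{2}$; (3) $a+b+c>0$ and, with $\mu:=\frac{6a-3b}{a+b+c}$, $(a+b)\max\{ -\mu,0\}+c\max\{2-\mu,0\}\ge1$. -}

module Defs where

open import Data.Nat as ℕ using (ℕ; _+_; _*_; _<_)
open import Data.Nat.Base using (NonZero; >-nonZero)
open import Data.Integer as ℤ using (ℤ; +_)
open import Data.Rational as ℚ using (ℚ; _/_; _⊔_; _≤_; 0ℚ; 1ℚ)
open import Data.Product using (Σ; ∃; _×_)
open import Relation.Binary.PropositionalEquality using (_≡_)

MultipleOf : ℕ → ℕ → ℕ → (ℕ × ℕ × ℕ) → Set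
MultipleOf a b c (x Data.Product., y Data.Product., z) =
  ∃ λ (k : ℕ) → (a ≡ k * x) × (b ≡ k * y) × (c ≡ k * z)

ι : ℕ → ℚ
ι n = (+ n) / 1

μ : (a b c : ℕ) → 0 < a + b + c → ℚ
μ a b c pos = _/_ ((+ (6 * a)) ℤ.- (+ (3 * b))) (a + b + c) {{>-nonZero pos}}

Cond3 : (a b c : ℕ) → Set
Cond3 a b c = Σ (0 < a + b + c) λ pos →
  1ℚ ≤ (ι (a + b) ℚ.* ((ℚ.- μ a b c pos) ⊔ 0ℚ)
        ℚ.+ ι c ℚ.* ((ι 2 ℚ.- μ a b c pos) ⊔ 0ℚ))

module Submission where

-- Write s = a + b + c, so that s μ = 6a − 3b.  As t ⊔ 0 is at least t and at least 0, the left
-- side of (3) dominates both (a + b)(−μ) + c(2 − μ) = 2c + 3b − 6a and c(2 − μ) = c(2s + 3b − 6a)/s.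
-- Suppose (2) fails, i.e. 2a ≤ b + c.  If 6a < 3b + 2c the first bound is at least 1.  Otherwise
-- 3b + 2c ≤ 6a: for c = 0 this forces b = 2a, and b = 0, c = 2a is a multiple of (1, 0, 2); in the
-- remaining cases (b = 0 < c − 2a, or b, c ≥ 1) the second bound is at least 1, which is the
-- polynomial inequality s + 6ac ≤ c(2s + 3b).

open import Defs
open import Data.Nat as ℕ using (ℕ; zero; suc; z<s; NonZero; _+_; _*_)
import Data.Nat.Properties as ℕP
open import Data.Nat.Tactic.RingSolver using () renaming (solve-∀ to ℕ-solve-∀)
open import Data.Integer as ℤ using (ℤ; +_)
import Data.Integer.Properties as ℤP
open import Data.Integer.Tactic.RingSolver using () renaming (solve-∀ to ℤ-solve-∀)
open import Data.Rational as ℚ using (ℚ; _/_; toℚᵘ; 0ℚ; 1ℚ; _⊔_; _<_)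
import Data.Rational.Properties as ℚP
open import Data.Rational.Solver using (module +-*-Solver)
open import Data.Rational.Unnormalised as ℚᵘ using (mkℚᵘ; *≡*; *≤*; *<*)
import Data.Rational.Unnormalised.Properties as ℚᵘP
open import Data.Product using (_,_)
open import Data.Sum using (_⊎_; inj₁; inj₂; map₂)
open import Relation.Binary.PropositionalEquality
open import Relation.Nullary using (yes; no)

toℚᵘ-/ : ∀ z k → toℚᵘ (z / suc k) ℚᵘ.≃ mkℚᵘ z k
toℚᵘ-/ z k = ℚP.toℚᵘ-fromℚᵘ (mkℚᵘ z k)

fromℤ : ℤ → ℚ
fromℤ z = z / 1

fromℤ-homo-+ : ∀ x y → fromℤ (x ℤ.+ y) ≡ fromℤ x ℚ.+ fromℤ y
fromℤ-homo-+ x y = ℚP.toℚᵘ-injective (begin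
  toℚᵘ (fromℤ (x ℤ.+ y))               ≈⟨ toℚᵘ-/ (x ℤ.+ y) 0 ⟩
  mkℚᵘ (x ℤ.+ y) 0                     ≈⟨ *≡* (cross-multiplied x y) ⟩
  mkℚᵘ x 0 ℚᵘ.+ mkℚᵘ y 0               ≈⟨ ℚᵘP.+-cong (toℚᵘ-/ x 0) (toℚᵘ-/ y 0) ⟨
  toℚᵘ (fromℤ x) ℚᵘ.+ toℚᵘ (fromℤ y)   ≈⟨ ℚP.toℚᵘ-homo-+ (fromℤ x) (fromℤ y) ⟨
  toℚᵘ (fromℤ x ℚ.+ fromℤ y)           ∎)
  where
  open ℚᵘP.≃-Reasoning
  cross-multiplied : ∀ x y → (x ℤ.+ y) ℤ.* + 1 ≡ (x ℤ.* + 1 ℤ.+ y ℤ.* + 1) ℤ.* + 1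
  cross-multiplied = ℤ-solve-∀

fromℤ-homo-* : ∀ x y → fromℤ (x ℤ.* y) ≡ fromℤ x ℚ.* fromℤ y
fromℤ-homo-* x y = ℚP.toℚᵘ-injective (begin
  toℚᵘ (fromℤ (x ℤ.* y))               ≈⟨ toℚᵘ-/ (x ℤ.* y) 0 ⟩
  mkℚᵘ (x ℤ.* y) 0                     ≈⟨ *≡* refl ⟩
  mkℚᵘ x 0 ℚᵘ.* mkℚᵘ y 0               ≈⟨ ℚᵘP.*-cong (toℚᵘ-/ x 0) (toℚᵘ-/ y 0) ⟨
  toℚᵘ (fromℤ x) ℚᵘ.* toℚᵘ (fromℤ y)   ≈⟨ ℚP.toℚᵘ-homo-* (fromℤ x) (fromℤ y) ⟨
  toℚᵘ (fromℤ x ℚ.* fromℤ y)           ∎)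
  where open ℚᵘP.≃-Reasoning

fromℤ-*-/ : ∀ k z .{{_ : NonZero k}} → fromℤ (+ k) ℚ.* (z / k) ≡ fromℤ z
fromℤ-*-/ (suc k) z = ℚP.toℚᵘ-injective (begin
  toℚᵘ (fromℤ (+ suc k) ℚ.* (z / suc k))          ≈⟨ ℚP.toℚᵘ-homo-* (fromℤ (+ suc k)) (z / suc k) ⟩
  toℚᵘ (fromℤ (+ suc k)) ℚᵘ.* toℚᵘ (z / suc k)    ≈⟨ ℚᵘP.*-cong (toℚᵘ-/ (+ suc k) 0) (toℚᵘ-/ z k) ⟩
  mkℚᵘ (+ suc k) 0 ℚᵘ.* mkℚᵘ z k                  ≈⟨ *≡* cross-multiplied ⟩
  mkℚᵘ z 0                                        ≈⟨ toℚᵘ-/ z 0 ⟨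
  toℚᵘ (fromℤ z)                                  ∎)
  where
  open ℚᵘP.≃-Reasoning
  -- the denominator of 1 * suc k computes to suc (k + 0)
  cross-multiplied : (+ suc k ℤ.* z) ℤ.* + 1 ≡ z ℤ.* + suc (k ℕ.+ 0)
  cross-multiplied = trans (ℤP.*-identityʳ _) (trans (ℤP.*-comm (+ suc k) z)
    (cong (λ n → z ℤ.* + suc n) (sym (ℕP.+-identityʳ k))))

fromℤ-mono-≤ : ∀ {x y} → x ℤ.≤ y → fromℤ x ℚ.≤ fromℤ y
fromℤ-mono-≤ {x} {y} x≤y = ℚP.toℚᵘ-cancel-≤ (begin
  toℚᵘ (fromℤ x)  ≃⟨ toℚᵘ-/ x 0 ⟩
  mkℚᵘ x 0        ≤⟨ *≤* (ℤP.*-monoʳ-≤-nonNeg (+ 1) x≤y) ⟩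
  mkℚᵘ y 0        ≃⟨ toℚᵘ-/ y 0 ⟨
  toℚᵘ (fromℤ y)  ∎)
  where open ℚᵘP.≤-Reasoning

fromℤ-mono-< : ∀ {x y} → x ℤ.< y → fromℤ x ℚ.< fromℤ y
fromℤ-mono-< {x} {y} x<y = ℚP.toℚᵘ-cancel-< (begin-strict
  toℚᵘ (fromℤ x)  ≃⟨ toℚᵘ-/ x 0 ⟩
  mkℚᵘ x 0        <⟨ *<* (ℤP.*-monoʳ-<-pos (+ 1) x<y) ⟩
  mkℚᵘ y 0        ≃⟨ toℚᵘ-/ y 0 ⟨
  toℚᵘ (fromℤ y)  ∎)
  where open ℚᵘP.≤-Reasoning

ι-nonNeg : ∀ n → ℚ.NonNegative (ι n)
ι-nonNeg n = ℚP.normalize-nonNeg n 1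

ι-pos : ∀ n .{{_ : NonZero n}} → ℚ.Positive (ι n)
ι-pos n = ℚP.normalize-pos n 1

ι-homo-+ : ∀ m n → ι (m + n) ≡ ι m ℚ.+ ι n
ι-homo-+ m n = trans (cong fromℤ (ℤP.pos-+ m n)) (fromℤ-homo-+ (+ m) (+ n))

ι-homo-* : ∀ m n → ι (m * n) ≡ ι m ℚ.* ι n
ι-homo-* m n = trans (cong fromℤ (ℤP.pos-* m n)) (fromℤ-homo-* (+ m) (+ n))

ι-mono-≤ : ∀ {m n} → m ℕ.≤ n → ι m ℚ.≤ ι n
ι-mono-≤ m≤n = fromℤ-mono-≤ (ℤ.+≤+ m≤n)

ι-mono-< : ∀ {m n} → m ℕ.< n → ι m ℚ.< ι n
ι-mono-< m<n = fromℤ-mono-< (ℤ.+<+ m<n)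

ι-*-[-]/ : ∀ k m n .{{_ : NonZero k}} → ι k ℚ.* ((+ m ℤ.- + n) / k) ℚ.+ ι n ≡ ι m
ι-*-[-]/ k m n = begin
  ι k ℚ.* ((+ m ℤ.- + n) / k) ℚ.+ ι n  ≡⟨ cong (ℚ._+ ι n) (fromℤ-*-/ k (+ m ℤ.- + n)) ⟩
  fromℤ (+ m ℤ.- + n) ℚ.+ fromℤ (+ n)   ≡⟨ fromℤ-homo-+ (+ m ℤ.- + n) (+ n) ⟨
  fromℤ (+ m ℤ.- + n ℤ.+ + n)           ≡⟨ cong fromℤ (minus-plus (+ m) (+ n)) ⟩
  ι m                                   ∎
  where
  open ≡-Reasoning
  minus-plus : ∀ x y → x ℤ.- y ℤ.+ y ≡ x
  minus-plus = ℤ-solve-∀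

/-<-ι : ∀ {m} k n .{{_ : NonZero k}} → m ℕ.< k * n → (+ m) / k ℚ.< ι n
/-<-ι {m} k n m<kn = ℚP.*-cancelˡ-<-nonNeg (ι k) {{ι-nonNeg k}} (begin-strict
  ι k ℚ.* ((+ m) / k)  ≡⟨ fromℤ-*-/ k (+ m) ⟩
  ι m                  <⟨ ι-mono-< m<kn ⟩
  ι (k * n)            ≡⟨ ι-homo-* k n ⟩
  ι k ℚ.* ι n          ∎)
  where open ℚP.≤-Reasoning

+-cancelʳ-≤ : ∀ r {p q} → p ℚ.+ r ℚ.≤ q ℚ.+ r → p ℚ.≤ q
+-cancelʳ-≤ r {p} {q} p+r≤q+r =
  subst₂ ℚ._≤_ (plus-minus p r) (plus-minus q r) (ℚP.+-monoˡ-≤ (ℚ.- r) p+r≤q+r)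
  where
  open +-*-Solver
  plus-minus : ∀ x y → x ℚ.+ y ℚ.- y ≡ x
  plus-minus = solve 2 (λ x y → x :+ y :- y := x) refl

ι≤-offset : ∀ m n {k} x → x ℚ.+ ι n ≡ ι k → m + n ℕ.≤ k → ι m ℚ.≤ x
ι≤-offset m n {k} x x+n≡k m+n≤k = +-cancelʳ-≤ (ι n) (begin
  ι m ℚ.+ ι n  ≡⟨ ι-homo-+ m n ⟨
  ι (m + n)    ≤⟨ ι-mono-≤ m+n≤k ⟩
  ι k          ≡⟨ x+n≡k ⟨
  x ℚ.+ ι n    ∎)
  where open ℚP.≤-Reasoning

LinearBound : ℕ → ℕ → ℕ → Set
LinearBound a b c = 1 + 6 * a ℕ.≤ 3 * b + 2 * c

RightBound : ℕ → ℕ → ℕ → Set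
RightBound a b c = a + b + c + c * (6 * a) ℕ.≤ c * (2 * (a + b + c) + 3 * b)

module _ (a b c : ℕ) (pos : 0 ℕ.< a + b + c) where
  open +-*-Solver

  private
    s = a + b + c
    A = ι (a + b)
    C = ι c
    S = ι s
    B = ι (3 * b)
    M = μ a b c pos

    s*μ+3b≡6a : S ℚ.* M ℚ.+ B ≡ ι (6 * a)
    s*μ+3b≡6a = ι-*-[-]/ s (6 * a) (3 * b) {{ℕ.>-nonZero pos}}

    S≡A+C : S ≡ A ℚ.+ C
    S≡A+C = ι-homo-+ (a + b) c

    X = A ℚ.* (ℚ.- M) ℚ.+ C ℚ.* (ι 2 ℚ.- M)
    Y = C ℚ.* (ι 2 ℚ.- M)

    X+6a≡3b+2c : X ℚ.+ ι (6 * a) ≡ ι (3 * b + 2 * c)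
    X+6a≡3b+2c = begin
      X ℚ.+ ι (6 * a)                  ≡⟨ cong (X ℚ.+_) s*μ+3b≡6a ⟨
      X ℚ.+ (S ℚ.* M ℚ.+ B)            ≡⟨ cong (λ S → X ℚ.+ (S ℚ.* M ℚ.+ B)) S≡A+C ⟩
      X ℚ.+ ((A ℚ.+ C) ℚ.* M ℚ.+ B)    ≡⟨ solve 5 (λ A C M B T →
                                            A :* (:- M) :+ C :* (T :- M) :+ ((A :+ C) :* M :+ B) := B :+ T :* C)
                                            refl A C M B (ι 2) ⟩
      B ℚ.+ ι 2 ℚ.* C                  ≡⟨ cong (B ℚ.+_) (ι-homo-* 2 c) ⟨
      B ℚ.+ ι (2 * c)                  ≡⟨ ι-homo-+ (3 * b) (2 * c) ⟨
      ι (3 * b + 2 * c)                ∎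
      where open ≡-Reasoning

    sY+6ac≡c[2s+3b] : S ℚ.* Y ℚ.+ ι (c * (6 * a)) ≡ ι (c * (2 * s + 3 * b))
    sY+6ac≡c[2s+3b] = begin
      S ℚ.* Y ℚ.+ ι (c * (6 * a))         ≡⟨ cong (S ℚ.* Y ℚ.+_) (ι-homo-* c (6 * a)) ⟩
      S ℚ.* Y ℚ.+ C ℚ.* ι (6 * a)         ≡⟨ cong (λ v → S ℚ.* Y ℚ.+ C ℚ.* v) s*μ+3b≡6a ⟨
      S ℚ.* Y ℚ.+ C ℚ.* (S ℚ.* M ℚ.+ B)   ≡⟨ solve 5 (λ S C M B T →
                                               S :* (C :* (T :- M)) :+ C :* (S :* M :+ B) := C :* (T :* S :+ B))
                                               refl S C M B (ι 2) ⟩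
      C ℚ.* (ι 2 ℚ.* S ℚ.+ B)             ≡⟨ cong (λ v → C ℚ.* (v ℚ.+ B)) (ι-homo-* 2 s) ⟨
      C ℚ.* (ι (2 * s) ℚ.+ B)             ≡⟨ cong (C ℚ.*_) (ι-homo-+ (2 * s) (3 * b)) ⟨
      C ℚ.* ι (2 * s + 3 * b)             ≡⟨ ι-homo-* c (2 * s + 3 * b) ⟨
      ι (c * (2 * s + 3 * b))             ∎
      where open ≡-Reasoning

    Q : ℚ
    Q = A ℚ.* ((ℚ.- M) ⊔ 0ℚ) ℚ.+ C ℚ.* ((ι 2 ℚ.- M) ⊔ 0ℚ)

  linearBound⇒Cond3 : LinearBound a b c → Cond3 a b c
  linearBound⇒Cond3 bound = pos , (begin
    1ℚ  ≤⟨ ι≤-offset 1 (6 * a) X X+6a≡3b+2c bound ⟩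
    X   ≤⟨ ℚP.+-mono-≤
             (ℚP.*-monoˡ-≤-nonNeg A {{ι-nonNeg (a + b)}} (ℚP.p≤p⊔q (ℚ.- M) 0ℚ))
             (ℚP.*-monoˡ-≤-nonNeg C {{ι-nonNeg c}} (ℚP.p≤p⊔q (ι 2 ℚ.- M) 0ℚ)) ⟩
    Q   ∎)
    where open ℚP.≤-Reasoning

  rightBound⇒Cond3 : RightBound a b c → Cond3 a b c
  rightBound⇒Cond3 bound = pos , (begin
    1ℚ               ≤⟨ 1≤Y ⟩
    Y                ≡⟨ ℚP.+-identityˡ Y ⟨
    0ℚ ℚ.+ Y         ≡⟨ cong (ℚ._+ Y) (ℚP.*-zeroʳ A) ⟨
    A ℚ.* 0ℚ ℚ.+ Y   ≤⟨ ℚP.+-mono-≤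
                          (ℚP.*-monoˡ-≤-nonNeg A {{ι-nonNeg (a + b)}} (ℚP.p≤q⊔p (ℚ.- M) 0ℚ))
                          (ℚP.*-monoˡ-≤-nonNeg C {{ι-nonNeg c}} (ℚP.p≤p⊔q (ι 2 ℚ.- M) 0ℚ)) ⟩
    Q                ∎)
    where
    open ℚP.≤-Reasoning
    1≤Y : 1ℚ ℚ.≤ Y
    1≤Y = ℚP.*-cancelˡ-≤-pos S {{ι-pos s {{ℕ.>-nonZero pos}}}}
      (subst (ℚ._≤ S ℚ.* Y) (sym (ℚP.*-identityʳ S))
        (ι≤-offset s (c * (6 * a)) (S ℚ.* Y) sY+6ac≡c[2s+3b] bound))

linearBound⇒positive : ∀ a b c → LinearBound a b c → 0 ℕ.< a + b + c
linearBound⇒positive a zero    zero    ()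
linearBound⇒positive a zero    (suc c) _ = ℕP.m≤n⇒m≤o+n (a + 0) z<s
linearBound⇒positive a (suc b) c       _ = ℕP.m≤n⇒m≤n+o c (ℕP.m≤n⇒m≤o+n a z<s)

rightBound-b≡0 : ∀ a c → 2 * a ℕ.< c → RightBound a 0 c
rightBound-b≡0 a _ 2a<c with ℕP.m≤n⇒∃[o]m+o≡n 2a<c
... | e , refl = begin
  a + 0 + c + c * (6 * a)                                                ≤⟨ ℕP.m≤m+n _ _ ⟩
  a + 0 + c + c * (6 * a) + (a + 4 * a * e + 1 + 3 * e + 2 * e * e)     ≡⟨ slack a e ⟩
  c * (2 * (a + 0 + c) + 3 * 0)                                          ∎
  where
  open ℕP.≤-Reasoning
  c = 1 + 2 * a + e
  slack : ∀ a e → let c = 1 + 2 * a + e in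
    a + 0 + c + c * (6 * a) + (a + 4 * a * e + 1 + 3 * e + 2 * e * e) ≡ c * (2 * (a + 0 + c) + 3 * 0)
  slack = ℕ-solve-∀

rightBound-nonZero : ∀ a b c .{{_ : NonZero b}} .{{_ : NonZero c}} → 2 * a ℕ.≤ b + c → RightBound a b c
rightBound-nonZero a b c 2a≤b+c = ℕP.*-cancelˡ-≤ 2 (begin
  2 * (a + b + c + c * (6 * a))                           ≡⟨ e₁ a b c ⟩
  2 * a + (2 * b + 2 * c) + 4 * c * (2 * a) + 4 * a * c    ≤⟨ ℕP.+-monoˡ-≤ (4 * a * c)
                                                               (ℕP.+-mono-≤ (ℕP.+-monoˡ-≤ (2 * b + 2 * c) 2a≤b+c)
                                                                            (ℕP.*-monoʳ-≤ (4 * c) 2a≤b+c)) ⟩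
  b + c + (2 * b + 2 * c) + 4 * c * (b + c) + 4 * a * c    ≡⟨ e₂ a b c ⟩
  3 * b + 3 * c + (4 * b * c + 4 * c * c + 4 * a * c)      ≤⟨ ℕP.+-monoˡ-≤ (4 * b * c + 4 * c * c + 4 * a * c)
                                                               (ℕP.+-mono-≤ (ℕP.*-monoʳ-≤ 3 (ℕP.m≤m*n b c))
                                                                            (ℕP.*-monoʳ-≤ 3 (ℕP.m≤n*m c b))) ⟩
  3 * (b * c) + 3 * (b * c) + (4 * b * c + 4 * c * c + 4 * a * c)   ≡⟨ e₃ a b c ⟩
  2 * (c * (2 * (a + b + c) + 3 * b))                     ∎)
  where
  open ℕP.≤-Reasoning
  e₁ : ∀ a b c → 2 * (a + b + c + c * (6 * a))
                 ≡ 2 * a + (2 * b + 2 * c) + 4 * c * (2 * a) + 4 * a * c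
  e₁ = ℕ-solve-∀
  e₂ : ∀ a b c → b + c + (2 * b + 2 * c) + 4 * c * (b + c) + 4 * a * c
                 ≡ 3 * b + 3 * c + (4 * b * c + 4 * c * c + 4 * a * c)
  e₂ = ℕ-solve-∀
  e₃ : ∀ a b c → 3 * (b * c) + 3 * (b * c) + (4 * b * c + 4 * c * c + 4 * a * c)
                 ≡ 2 * (c * (2 * (a + b + c) + 3 * b))
  e₃ = ℕ-solve-∀

multipleOf⊎Cond3 : ∀ a b c → 2 * a ℕ.≤ b + c → 3 * b + 2 * c ℕ.≤ 6 * a →
  (MultipleOf a b c (1 , 2 , 0) ⊎ MultipleOf a b c (1 , 0 , 2)) ⊎ Cond3 a b c
multipleOf⊎Cond3 a b zero 2a≤b 3b≤6a =
  inj₁ (inj₁ (a , sym (ℕP.*-identityʳ a) , trans b≡2a (ℕP.*-comm 2 a) , sym (ℕP.*-zeroʳ a)))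
  where
  b≡2a : b ≡ 2 * a
  b≡2a = ℕP.≤-antisym
    (ℕP.*-cancelˡ-≤ 3 (subst₂ ℕ._≤_ (ℕP.+-identityʳ (3 * b)) (ℕP.*-assoc 3 2 a) 3b≤6a))
    (subst (2 * a ℕ.≤_) (ℕP.+-identityʳ b) 2a≤b)
multipleOf⊎Cond3 a zero c@(suc _) 2a≤c _ with c ℕ.≟ 2 * a
... | yes c≡2a = inj₁ (inj₂ (a , sym (ℕP.*-identityʳ a) , sym (ℕP.*-zeroʳ a) , trans c≡2a (ℕP.*-comm 2 a)))
... | no  c≢2a = inj₂ (rightBound⇒Cond3 a 0 c (ℕP.m≤n⇒m≤o+n (a + 0) z<s)
                        (rightBound-b≡0 a c (ℕP.≤∧≢⇒< 2a≤c (≢-sym c≢2a))))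
multipleOf⊎Cond3 a b@(suc _) c@(suc _) 2a≤b+c _ =
  inj₂ (rightBound⇒Cond3 a b c (ℕP.m≤n⇒m≤o+n (a + b) z<s) (rightBound-nonZero a b c 2a≤b+c))

lemma6p10 : (a b c : ℕ) →
    (MultipleOf a b c (1 , 2 , 0) ⊎ MultipleOf a b c (1 , 0 , 2))
    ⊎ ((+ (b + c)) / 2 < ι a)
    ⊎ Cond3 a b c
lemma6p10 a b c with b + c ℕ.<? 2 * a | 1 + 6 * a ℕ.≤? 3 * b + 2 * c
... | yes b+c<2a | _        = inj₂ (inj₁ (/-<-ι 2 a b+c<2a))
... | no  b+c≮2a | yes lin  = inj₂ (inj₂ (linearBound⇒Cond3 a b c (linearBound⇒positive a b c lin) lin))
... | no  b+c≮2a | no  ¬lin = map₂ inj₂ (multipleOf⊎Cond3 a b c (ℕP.≮⇒≥ b+c≮2a) (ℕP.≤-pred (ℕP.≰⇒> ¬lin)))
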